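{- Let $m\ge 2$ and $1\le i\le m$. Then, as formal power series, \[ \sum_{\lambda \in \mathcal{P}} s^{|\lambda|}\, q^{\sum_{k = 0}^\infty \sum_{j=1}^i \lambda_{km+j}} = \frac{1}{\prod_{r=1}^{i}(s^rq^r;s^mq^i)_\infty\ \prod_{r=i+1}^{m}(s^rq^i;s^mq^i)_\infty}, \] where $\mathcal{P}$ is the set of all partitions (an empty product equals $1$).
   Context: A partition $\lambda$ is a weakly decreasing sequence $(\lambda_1,\dots,\lambda_\ell)$ of positive integers with $\lambda_k=0$ for $k>\ell$; $|\lambda|$ is the sum of its parts. $(z;Q)_\infty=\prod_{r\ge0}(1-zQ^r)$. -}

module Defs where

open import Data.Nat as ℕ using (ℕ; zero; suc; _≤_; _<_; _∸_; _≤?_; _<?_)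
open import Data.Nat.DivMod using (_%_)
open import Data.Integer using (ℤ; +_; _-_) renaming (_+_ to _+ℤ_; _*_ to _*ℤ_)
open import Data.List using (List; []; _∷_)
open import Data.Nat.ListAction using (sum)
open import Data.List.Relation.Unary.All using (All)
open import Data.List.Relation.Unary.Linked using (Linked)
open import Data.Product using (Σ; _×_)
open import Relation.Binary.PropositionalEquality using (_≡_)
open import Relation.Nullary.Decidable using (does)
open import Data.Bool using (if_then_else_; _∧_)

-- A partition: weakly decreasing list of positive integers
-- (λ₁ ≥ λ₂ ≥ … ≥ λ_ℓ > 0), with λ_k = 0 for k > ℓ implicitly.
IsPartition : List ℕ → Set
IsPartition l = Linked (λ a b → b ≤ a) l × All (λ a → 0 < a) l

size : List ℕ → ℕ
size = sum

-- weightFrom m i p l : sum of λ_{p}, λ_{p+1}, … (1-based index p for the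
-- head of l) keeping only positions of the form km + j with 1 ≤ j ≤ i,
-- i.e. positions p with (p ∸ 1) % m < i.  (Positions beyond the length
-- contribute 0.)
weightFrom : (m i : ℕ) → .{{_ : ℕ.NonZero m}} → ℕ → List ℕ → ℕ
weightFrom m i p [] = 0
weightFrom m i p (x ∷ l) =
  (if does (((p ∸ 1) % m) <? i) then x else 0) ℕ.+ weightFrom m i (suc p) l

stat : (m i : ℕ) → .{{_ : ℕ.NonZero m}} → List ℕ → ℕ
stat m i = weightFrom m i 1

PartSet : (m i : ℕ) → .{{_ : ℕ.NonZero m}} → ℕ → ℕ → Set
PartSet m i n k =
  Σ (List ℕ) (λ l → IsPartition l × size l ≡ n × stat m i l ≡ k)

-- Formal power series in two variables s, q over ℤ:
-- F a b = coefficient of s^a q^b.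

FPS : Set
FPS = ℕ → ℕ → ℤ

sumTo : ℕ → (ℕ → ℤ) → ℤ
sumTo zero    f = f 0
sumTo (suc n) f = sumTo n f +ℤ f (suc n)

_*F_ : FPS → FPS → FPS
(f *F g) a b = sumTo a (λ a₁ → sumTo b (λ b₁ → f a₁ b₁ *ℤ g (a ∸ a₁) (b ∸ b₁)))

δ : ℕ → ℕ → ℤ
δ zero zero = + 1
δ _    _    = + 0

mono : ℕ → ℕ → FPS
mono c d a b = if does (a ℕ.≟ c) ∧ does (b ℕ.≟ d) then + 1 else + 0

oneF : FPS
oneF = mono 0 0

oneMinus : ℕ → ℕ → FPS
oneMinus c d a b = oneF a b - mono c d a b

prodBelow : ℕ → (ℕ → FPS) → FPS
prodBelow zero    f = oneF
prodBelow (suc N) f = prodBelow N f *F f N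

prodFrom : ℕ → ℕ → (ℕ → FPS) → FPS
prodFrom lo len f = prodBelow len (λ j → f (lo ℕ.+ j))

-- Truncated q-Pochhammer symbol with z = s^c q^d and Q = s^C q^D:
--   (z;Q)_N = ∏_{t=0}^{N-1} (1 - s^{c+Ct} q^{d+Dt}).
poch : (c d C D N : ℕ) → FPS
poch c d C D N = prodBelow N (λ t → oneMinus (c ℕ.+ C ℕ.* t) (d ℕ.+ D ℕ.* t))

-- Truncation at N of the denominator
--   ∏_{r=1}^{i} (s^r q^r; s^m q^i)_∞ · ∏_{r=i+1}^{m} (s^r q^i; s^m q^i)_∞ .
-- The infinite product is the limit (in the (s)-adic topology) of these
-- truncations as N → ∞.
denomTrunc : (m i N : ℕ) → FPS
denomTrunc m i N =
  prodFrom 1 i (λ r → poch r r m i N) *F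
  prodFrom (suc i) (m ∸ i) (λ r → poch r i m i N)

toFPS : (ℕ → ℕ → ℕ) → FPS
toFPS L a b = + (L a b)

{-# OPTIONS --safe #-}
-- Encode a partition λ by its column multiplicities v_k = λ_k − λ_(k+1) (k ≥ 1).  Then
-- |λ| = Σ k v_k and the statistic is Σ w(k) v_k, where w(k) counts the positions p ≤ k with
-- p ≡ 1, …, i (mod m); so the series is ∏_(k ≥ 1) 1 / (1 − s^k q^w(k)).  Since
-- w(mt + r) = it + min(r, i), the binomials with k ≤ mN are, up to order, those of the
-- truncated denominator, and columns of height k > mN ≥ N cannot occur when |λ| < N.
-- The product itself is handled for an arbitrary list of binomials 1 − s^c q^d with c ≥ 1:
-- multiplying the series counting the solutions of Σ v_k (c_k, d_k) = (a, b) by one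
-- binomial removes the corresponding v_k, and the count is invariant under reordering.
module Submission where

open import Defs
open import Data.Nat using (ℕ; _≤_; _<_; NonZero)
open import Data.Fin using (Fin)
open import Function.Bundles using (_↔_)
open import Relation.Binary.PropositionalEquality using (_≡_)

open import Algebra.Bundles using (CommutativeMonoid)
import Algebra.Properties.CommutativeSemigroup as CommutativeSemigroupProperties
open import Data.Bool using (Bool; true; false; if_then_else_; _∧_)
open import Data.Bool.Properties using (if-float; if-eta)
open import Data.Empty using (⊥-elim)
open import Data.Fin using (zero)
open import Data.Fin.Permutation using (↔⇒≡)
open import Data.Fin.Properties using (+↔⊎)
open import Data.Integer using (ℤ; +_) renaming (_+_ to _+ℤ_; _*_ to _*ℤ_; _-_ to _-ℤ_)
import Data.Integer.Properties as ℤP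
import Data.Integer.Tactic.RingSolver as ℤ-Ring
open import Data.List using (List; []; _∷_; _++_; [_]; length)
import Data.List.Properties as List
open import Data.List.Relation.Binary.Permutation.Propositional as ↭
  using (_↭_; ↭-sym; ↭-trans; ↭-reflexive; module PermutationReasoning)
open import Data.List.Relation.Binary.Permutation.Propositional.Properties
  using (↭-sym-involutive; ++⁺; ++⁺ʳ; ++-commutativeMonoid; All-resp-↭)
open import Data.List.Relation.Unary.All as All using (All; []; _∷_)
open import Data.List.Relation.Unary.Linked as Linked using ([]; [-]; _∷_)
open import Data.Nat using (zero; suc; _+_; _*_; _∸_; _⊓_; z≤n; s≤s)
open import Data.Nat.DivMod using (_%_; [m+kn]%n≡m%n; m<n⇒m%n≡m)
open import Data.Nat.Induction using (<-rec)
open import Data.Nat.Properties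
import Data.Nat.Tactic.RingSolver as ℕ-Ring
open import Data.Product using (Σ; _×_; _,_; proj₁; proj₂)
open import Data.Sum using (_⊎_; inj₁; inj₂)
open import Data.Sum.Function.Propositional using (_⊎-↔_)
open import Data.Vec as Vec using (Vec; []; _∷_)
open import Function.Bundles using (mk↔ₛ′)
open import Function.Properties.Inverse using (↔-trans; ↔-sym)
open import Relation.Binary.PropositionalEquality
  using (_≢_; refl; sym; trans; cong; cong₂; subst; module ≡-Reasoning)
open import Relation.Nullary using (Irrelevant; Dec; yes; no; does; ¬_; contradiction)

open CommutativeSemigroupProperties +-commutativeSemigroup using (x∙yz≈y∙xz)

-- Finite sums

if-yes : ∀ {P : Set} (P? : Dec P) {A : Set} {x y : A} → P → (if does P? then x else y) ≡ x
if-yes (yes _) _ = refl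
if-yes (no ¬p) p = contradiction p ¬p

if-no : ∀ {P : Set} (P? : Dec P) {A : Set} {x y : A} → ¬ P → (if does P? then x else y) ≡ y
if-no (yes p) ¬p = contradiction p ¬p
if-no (no _)  _  = refl

sumTo-cong : ∀ n {F G : ℕ → ℤ} → (∀ x → x ≤ n → F x ≡ G x) → sumTo n F ≡ sumTo n G
sumTo-cong zero    F≡G = F≡G 0 z≤n
sumTo-cong (suc n) F≡G =
  cong₂ _+ℤ_ (sumTo-cong n λ x x≤n → F≡G x (m≤n⇒m≤1+n x≤n)) (F≡G (suc n) ≤-refl)

sumTo-zero : ∀ n {F : ℕ → ℤ} → (∀ x → x ≤ n → F x ≡ + 0) → sumTo n F ≡ + 0
sumTo-zero zero    F≡0 = F≡0 0 z≤n
sumTo-zero (suc n) F≡0 =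
  cong₂ _+ℤ_ (sumTo-zero n λ x x≤n → F≡0 x (m≤n⇒m≤1+n x≤n)) (F≡0 (suc n) ≤-refl)

sumTo-shrink : ∀ {k} n {F : ℕ → ℤ} → k ≤ n → (∀ x → k < x → x ≤ n → F x ≡ + 0) →
               sumTo n F ≡ sumTo k F
sumTo-shrink zero    z≤n _ = refl
sumTo-shrink {k} (suc n) {F} k≤1+n F≡0 with m≤n⇒m<n∨m≡n k≤1+n
... | inj₂ refl        = refl
... | inj₁ (s≤s k≤n) = trans
  (cong₂ _+ℤ_ (sumTo-shrink n k≤n λ x k<x x≤n → F≡0 x k<x (m≤n⇒m≤1+n x≤n))
              (F≡0 (suc n) (s≤s k≤n) ≤-refl))
  (ℤP.+-identityʳ (sumTo k F))

sumTo-last : ∀ n {F : ℕ → ℤ} → (∀ x → x < n → F x ≡ + 0) → sumTo n F ≡ F n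
sumTo-last zero    _   = refl
sumTo-last (suc n) {F} F≡0 =
  trans (cong (_+ℤ F (suc n)) (sumTo-zero n λ x x≤n → F≡0 x (s≤s x≤n))) (ℤP.+-identityˡ _)

sumTo-single : ∀ n k {F : ℕ → ℤ} → k ≤ n → (∀ x → x ≤ n → x ≢ k → F x ≡ + 0) →
               sumTo n F ≡ F k
sumTo-single n k k≤n F≡0 = trans
  (sumTo-shrink n k≤n λ x k<x x≤n → F≡0 x x≤n λ x≡k → <-irrefl (sym x≡k) k<x)
  (sumTo-last k λ x x<k → F≡0 x (≤-trans (<⇒≤ x<k) k≤n) λ x≡k → <-irrefl x≡k x<k)

sumTo-minus : ∀ n (F G : ℕ → ℤ) → sumTo n (λ x → F x -ℤ G x) ≡ sumTo n F -ℤ sumTo n G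
sumTo-minus zero    F G = refl
sumTo-minus (suc n) F G = trans
  (cong (_+ℤ (F (suc n) -ℤ G (suc n))) (sumTo-minus n F G))
  (interchange (sumTo n F) (sumTo n G) (F (suc n)) (G (suc n)))
  where
  interchange : ∀ a b c d → (a -ℤ b) +ℤ (c -ℤ d) ≡ (a +ℤ c) -ℤ (b +ℤ d)
  interchange = ℤ-Ring.solve-∀

sumTo-if : ∀ n (p : Bool) (F : ℕ → ℤ) →
           sumTo n (λ x → if p then F x else + 0) ≡ (if p then sumTo n F else + 0)
sumTo-if n true  F = refl
sumTo-if n false F = sumTo-zero n λ _ _ → refl

sumTo-select : ∀ b d (F : ℕ → ℤ) →
               sumTo b (λ y → if does (b ∸ y ≟ d) then F y else + 0)
               ≡ (if does (d ≤? b) then F (b ∸ d) else + 0)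
sumTo-select b d F with d ≤? b
... | yes d≤b = begin
  sumTo b (λ y → if does (b ∸ y ≟ d) then F y else + 0)
    ≡⟨ sumTo-single b (b ∸ d) (m∸n≤m b d) (λ y y≤b y≢ → if-no (b ∸ y ≟ d) λ b∸y≡d →
         y≢ (trans (sym (m∸[m∸n]≡n y≤b)) (cong (b ∸_) b∸y≡d))) ⟩
  (if does (b ∸ (b ∸ d) ≟ d) then F (b ∸ d) else + 0)
    ≡⟨ if-yes (b ∸ (b ∸ d) ≟ d) (m∸[m∸n]≡n d≤b) ⟩
  F (b ∸ d)
    ≡⟨ if-yes (d ≤? b) d≤b ⟨
  (if does (d ≤? b) then F (b ∸ d) else + 0) ∎
  where open ≡-Reasoning
... | no d≰b = trans
  (sumTo-zero b λ y _ → if-no (b ∸ y ≟ d) λ b∸y≡d → d≰b (subst (_≤ b) b∸y≡d (m∸n≤m b y)))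
  (sym (if-no (d ≤? b) d≰b))

sumTo-cutoff : ∀ n c (F : ℕ → ℤ) →
               sumTo n (λ x → if does (c ≤? n ∸ x) then F x else + 0)
               ≡ (if does (c ≤? n) then sumTo (n ∸ c) F else + 0)
sumTo-cutoff n c F with c ≤? n
... | yes c≤n = trans (trans (sumTo-shrink n (m∸n≤m n c) beyond) (sumTo-cong (n ∸ c) below))
                      (sym (if-yes (c ≤? n) c≤n))
  where
  beyond : ∀ x → n ∸ c < x → x ≤ n → (if does (c ≤? n ∸ x) then F x else + 0) ≡ + 0
  beyond x n∸c<x x≤n = if-no (c ≤? n ∸ x) λ c≤n∸x →
    <⇒≱ n∸c<x (subst (_≤ n ∸ c) (m∸[m∸n]≡n x≤n) (∸-monoʳ-≤ n c≤n∸x))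
  below : ∀ x → x ≤ n ∸ c → (if does (c ≤? n ∸ x) then F x else + 0) ≡ F x
  below x x≤n∸c = if-yes (c ≤? n ∸ x) (subst (_≤ n ∸ x) (m∸[m∸n]≡n c≤n) (∸-monoʳ-≤ n x≤n∸c))
... | no c≰n = trans
  (sumTo-zero n λ x _ → if-no (c ≤? n ∸ x) λ c≤n∸x → c≰n (≤-trans c≤n∸x (m∸n≤m n x)))
  (sym (if-no (c ≤? n) c≰n))

-- Multiplication by monomials and binomials

*ℤ-distribˡ-minus : ∀ z u w → z *ℤ (u -ℤ w) ≡ z *ℤ u -ℤ z *ℤ w
*ℤ-distribˡ-minus = ℤ-Ring.solve-∀

infix 4 _≈_

_≈_ : FPS → FPS → Set
f ≈ g = ∀ a b → f a b ≡ g a b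

≈-trans : ∀ {f g h} → f ≈ g → g ≈ h → f ≈ h
≈-trans f≈g g≈h a b = trans (f≈g a b) (g≈h a b)

*F-congˡ : ∀ {f g} h → f ≈ g → (f *F h) ≈ (g *F h)
*F-congˡ h f≈g a b =
  sumTo-cong a λ x _ → sumTo-cong b λ y _ → cong (_*ℤ h (a ∸ x) (b ∸ y)) (f≈g x y)

*F-congʳ : ∀ f {g h} → g ≈ h → (f *F g) ≈ (f *F h)
*F-congʳ f g≈h a b =
  sumTo-cong a λ x _ → sumTo-cong b λ y _ → cong (f x y *ℤ_) (g≈h (a ∸ x) (b ∸ y))

shift : ℕ → ℕ → FPS → FPS
shift c d f a b =
  if does (c ≤? a) then (if does (d ≤? b) then f (a ∸ c) (b ∸ d) else + 0) else + 0

*F-mono : ∀ c d f → (f *F mono c d) ≈ shift c d f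
*F-mono c d f a b = trans (sumTo-cong a λ x _ → inner x) (sumTo-select a c _)
  where
  times-indicator : ∀ (p q : Bool) z →
    z *ℤ (if p ∧ q then + 1 else + 0) ≡ (if p then (if q then z else + 0) else + 0)
  times-indicator true  true  z = ℤP.*-identityʳ z
  times-indicator true  false z = ℤP.*-zeroʳ z
  times-indicator false _     z = ℤP.*-zeroʳ z

  inner : ∀ x → sumTo b (λ y → f x y *ℤ mono c d (a ∸ x) (b ∸ y))
              ≡ (if does (a ∸ x ≟ c) then (if does (d ≤? b) then f x (b ∸ d) else + 0) else + 0)
  inner x = begin
    sumTo b (λ y → f x y *ℤ mono c d (a ∸ x) (b ∸ y))
      ≡⟨ sumTo-cong b (λ y _ → times-indicator (does (a ∸ x ≟ c)) (does (b ∸ y ≟ d)) (f x y)) ⟩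
    sumTo b (λ y → if does (a ∸ x ≟ c) then (if does (b ∸ y ≟ d) then f x y else + 0) else + 0)
      ≡⟨ sumTo-if b (does (a ∸ x ≟ c)) _ ⟩
    (if does (a ∸ x ≟ c) then sumTo b (λ y → if does (b ∸ y ≟ d) then f x y else + 0) else + 0)
      ≡⟨ cong (λ t → if does (a ∸ x ≟ c) then t else + 0) (sumTo-select b d (f x)) ⟩
    (if does (a ∸ x ≟ c) then (if does (d ≤? b) then f x (b ∸ d) else + 0) else + 0) ∎
    where open ≡-Reasoning

*F-identityʳ : ∀ f → (f *F oneF) ≈ f
*F-identityʳ f = *F-mono 0 0 f

*F-oneMinus : ∀ c d f a b → (f *F oneMinus c d) a b ≡ f a b -ℤ shift c d f a b
*F-oneMinus c d f a b = begin
  (f *F oneMinus c d) a b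
    ≡⟨ sumTo-cong a (λ x _ → trans (sumTo-cong b λ y _ → *ℤ-distribˡ-minus (f x y) _ _)
                                   (sumTo-minus b _ _)) ⟩
  sumTo a (λ x → sumTo b (λ y → f x y *ℤ oneF (a ∸ x) (b ∸ y))
                 -ℤ sumTo b (λ y → f x y *ℤ mono c d (a ∸ x) (b ∸ y)))
    ≡⟨ sumTo-minus a _ _ ⟩
  (f *F oneF) a b -ℤ (f *F mono c d) a b
    ≡⟨ cong₂ _-ℤ_ (*F-identityʳ f a b) (*F-mono c d f a b) ⟩
  f a b -ℤ shift c d f a b ∎
  where open ≡-Reasoning

*F-shiftʳ : ∀ c d f g → (f *F shift c d g) ≈ shift c d (f *F g)
*F-shiftʳ c d f g a b = begin
  sumTo a (λ x → sumTo b (λ y → f x y *ℤ shift c d g (a ∸ x) (b ∸ y)))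
    ≡⟨ sumTo-cong a (λ x _ → inner x) ⟩
  sumTo a (λ x → if does (c ≤? a ∸ x) then G x else + 0)
    ≡⟨ sumTo-cutoff a c G ⟩
  (if does (c ≤? a) then sumTo (a ∸ c) G else + 0)
    ≡⟨ cong (λ t → if does (c ≤? a) then t else + 0) outer ⟩
  shift c d (f *F g) a b ∎
  where
  open ≡-Reasoning
  times-if : ∀ (p q : Bool) z w → z *ℤ (if p then (if q then w else + 0) else + 0)
                                 ≡ (if p then (if q then z *ℤ w else + 0) else + 0)
  times-if true  true  z w = refl
  times-if true  false z w = ℤP.*-zeroʳ z
  times-if false _     z w = ℤP.*-zeroʳ z

  G : ℕ → ℤ
  G x = if does (d ≤? b)
        then sumTo (b ∸ d) (λ y → f x y *ℤ g (a ∸ x ∸ c) (b ∸ y ∸ d)) else + 0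

  inner : ∀ x → sumTo b (λ y → f x y *ℤ shift c d g (a ∸ x) (b ∸ y))
              ≡ (if does (c ≤? a ∸ x) then G x else + 0)
  inner x = begin
    sumTo b (λ y → f x y *ℤ shift c d g (a ∸ x) (b ∸ y))
      ≡⟨ sumTo-cong b (λ y _ → times-if (does (c ≤? a ∸ x)) (does (d ≤? b ∸ y)) (f x y) _) ⟩
    sumTo b (λ y → if does (c ≤? a ∸ x)
                   then (if does (d ≤? b ∸ y) then f x y *ℤ g (a ∸ x ∸ c) (b ∸ y ∸ d) else + 0)
                   else + 0)
      ≡⟨ sumTo-if b (does (c ≤? a ∸ x)) _ ⟩
    (if does (c ≤? a ∸ x)
     then sumTo b (λ y → if does (d ≤? b ∸ y) then f x y *ℤ g (a ∸ x ∸ c) (b ∸ y ∸ d) else + 0)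
     else + 0)
      ≡⟨ cong (λ t → if does (c ≤? a ∸ x) then t else + 0) (sumTo-cutoff b d _) ⟩
    (if does (c ≤? a ∸ x) then G x else + 0) ∎

  ∸-comm : ∀ n x k → n ∸ x ∸ k ≡ n ∸ k ∸ x
  ∸-comm n x k = trans (∸-+-assoc n x k) (trans (cong (n ∸_) (+-comm x k)) (sym (∸-+-assoc n k x)))

  outer : sumTo (a ∸ c) G ≡ (if does (d ≤? b) then (f *F g) (a ∸ c) (b ∸ d) else + 0)
  outer = trans (sumTo-if (a ∸ c) (does (d ≤? b)) _)
    (cong (λ t → if does (d ≤? b) then t else + 0)
      (sumTo-cong (a ∸ c) λ x _ → sumTo-cong (b ∸ d) λ y _ →
        cong₂ (λ u v → f x y *ℤ g u v) (∸-comm a x c) (∸-comm b y d)))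

*F-assoc-oneMinus : ∀ c d f g → (f *F (g *F oneMinus c d)) ≈ ((f *F g) *F oneMinus c d)
*F-assoc-oneMinus c d f g a b = begin
  sumTo a (λ x → sumTo b (λ y → f x y *ℤ (g *F oneMinus c d) (a ∸ x) (b ∸ y)))
    ≡⟨ sumTo-cong a (λ x _ → trans
         (sumTo-cong b λ y _ → trans (cong (f x y *ℤ_) (*F-oneMinus c d g (a ∸ x) (b ∸ y)))
                                     (*ℤ-distribˡ-minus (f x y) _ _))
         (sumTo-minus b _ _)) ⟩
  sumTo a (λ x → sumTo b (λ y → f x y *ℤ g (a ∸ x) (b ∸ y))
                 -ℤ sumTo b (λ y → f x y *ℤ shift c d g (a ∸ x) (b ∸ y)))
    ≡⟨ sumTo-minus a _ _ ⟩
  (f *F g) a b -ℤ (f *F shift c d g) a b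
    ≡⟨ cong ((f *F g) a b -ℤ_) (*F-shiftʳ c d f g a b) ⟩
  (f *F g) a b -ℤ shift c d (f *F g) a b
    ≡⟨ *F-oneMinus c d (f *F g) a b ⟨
  ((f *F g) *F oneMinus c d) a b ∎
  where open ≡-Reasoning

-- Products of binomials

mulBinomials : FPS → List (ℕ × ℕ) → FPS
mulBinomials f []              = f
mulBinomials f ((c , d) ∷ cds) = mulBinomials (f *F oneMinus c d) cds

mulBinomials-cong : ∀ cds {f g} → f ≈ g → mulBinomials f cds ≈ mulBinomials g cds
mulBinomials-cong []              f≈g = f≈g
mulBinomials-cong ((c , d) ∷ cds) f≈g = mulBinomials-cong cds (*F-congˡ (oneMinus c d) f≈g)

mulBinomials-++ : ∀ cds cds′ f →
                  mulBinomials f (cds ++ cds′) ≡ mulBinomials (mulBinomials f cds) cds′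
mulBinomials-++ []              cds′ f = refl
mulBinomials-++ ((c , d) ∷ cds) cds′ f = mulBinomials-++ cds cds′ (f *F oneMinus c d)

*F-mulBinomials : ∀ cds f g → (f *F mulBinomials g cds) ≈ mulBinomials (f *F g) cds
*F-mulBinomials []              f g a b = refl
*F-mulBinomials ((c , d) ∷ cds) f g = ≈-trans
  (*F-mulBinomials cds f (g *F oneMinus c d))
  (mulBinomials-cong cds (*F-assoc-oneMinus c d f g))

mulBinomials-agreeBelow : ∀ N cds {f g} → (∀ a b → a < N → f a b ≡ g a b) →
                          ∀ a b → a < N → mulBinomials f cds a b ≡ mulBinomials g cds a b
mulBinomials-agreeBelow N []              f≡g = f≡g
mulBinomials-agreeBelow N ((c , d) ∷ cds) {f} {g} f≡g =
  mulBinomials-agreeBelow N cds λ a b a<N → begin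
    (f *F oneMinus c d) a b      ≡⟨ *F-oneMinus c d f a b ⟩
    f a b -ℤ shift c d f a b     ≡⟨ cong₂ _-ℤ_ (f≡g a b a<N) (shift-agree a b a<N) ⟩
    g a b -ℤ shift c d g a b     ≡⟨ *F-oneMinus c d g a b ⟨
    (g *F oneMinus c d) a b      ∎
  where
  open ≡-Reasoning
  shift-agree : ∀ a b → a < N → shift c d f a b ≡ shift c d g a b
  shift-agree a b a<N =
    cong (λ t → if does (c ≤? a) then (if does (d ≤? b) then t else + 0) else + 0)
         (f≡g (a ∸ c) (b ∸ d) (≤-<-trans (m∸n≤m a c) a<N))

-- Treating products as operators on f means *F is only ever reassociated against a
-- binomial (*F-assoc-oneMinus).
IsBinomialProduct : FPS → List (ℕ × ℕ) → Set
IsBinomialProduct g cds = ∀ f → (f *F g) ≈ mulBinomials f cds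

*F-isBinomialProduct : ∀ {g h cds cds′} → IsBinomialProduct g cds → IsBinomialProduct h cds′ →
                       IsBinomialProduct (g *F h) (cds ++ cds′)
*F-isBinomialProduct {g} {h} {cds} {cds′} g≈ h≈ f = ≈-trans (*F-congʳ f (h≈ g))
  (≈-trans (*F-mulBinomials cds′ f g)
  (≈-trans (mulBinomials-cong cds′ (g≈ f))
  λ a b → cong (λ F → F a b) (sym (mulBinomials-++ cds cds′ f))))

concatBelow : ∀ {A : Set} → ℕ → (ℕ → List A) → List A
concatBelow zero    xs = []
concatBelow (suc N) xs = concatBelow N xs ++ xs N

concatBelow-[] : ∀ {A : Set} K → concatBelow {A} K (λ _ → []) ≡ []
concatBelow-[] zero    = refl
concatBelow-[] (suc K) = trans (List.++-identityʳ _) (concatBelow-[] K)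

concatBelow-cong : ∀ {A : Set} K {xs ys : ℕ → List A} → (∀ j → xs j ≡ ys j) →
                   concatBelow K xs ≡ concatBelow K ys
concatBelow-cong zero    _     = refl
concatBelow-cong (suc K) xs≡ys = cong₂ _++_ (concatBelow-cong K xs≡ys) (xs≡ys K)

concatBelow-++ : ∀ {A : Set} K (xs ys : ℕ → List A) →
                 concatBelow K (λ j → xs j ++ ys j) ↭ concatBelow K xs ++ concatBelow K ys
concatBelow-++ zero    xs ys = ↭.refl
concatBelow-++ {A} (suc K) xs ys = ↭-trans
  (++⁺ʳ (xs K ++ ys K) (concatBelow-++ K xs ys))
  (interchange (concatBelow K xs) (concatBelow K ys) (xs K) (ys K))
  where
  open CommutativeSemigroupProperties
    (CommutativeMonoid.commutativeSemigroup (++-commutativeMonoid {A = A}))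

concatBelow-transpose : ∀ {A : Set} K N (f : ℕ → ℕ → List A) →
                        concatBelow K (λ j → concatBelow N (f j))
                        ↭ concatBelow N (λ t → concatBelow K (λ j → f j t))
concatBelow-transpose K zero    f = ↭-reflexive (concatBelow-[] K)
concatBelow-transpose K (suc N) f = ↭-trans
  (concatBelow-++ K (λ j → concatBelow N (f j)) (λ j → f j N))
  (++⁺ʳ _ (concatBelow-transpose K N f))

prodBelow-isBinomialProduct : ∀ N g cds → (∀ t → IsBinomialProduct (g t) (cds t)) →
                              IsBinomialProduct (prodBelow N g) (concatBelow N cds)
prodBelow-isBinomialProduct zero    g cds g≈ = *F-identityʳ
prodBelow-isBinomialProduct (suc N) g cds g≈ =
  *F-isBinomialProduct {prodBelow N g} {g N} {concatBelow N cds} {cds N}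
    (prodBelow-isBinomialProduct N g cds g≈) (g≈ N)

pochFactors : (c d C D N : ℕ) → List (ℕ × ℕ)
pochFactors c d C D N = concatBelow N λ t → [ (c + C * t , d + D * t) ]

denominatorFactors : (m i N : ℕ) → List (ℕ × ℕ)
denominatorFactors m i N = concatBelow i (λ j → pochFactors (1 + j) (1 + j) m i N)
                        ++ concatBelow (m ∸ i) (λ j → pochFactors (suc i + j) i m i N)

denomTrunc-isBinomialProduct : ∀ m i N → IsBinomialProduct (denomTrunc m i N) (denominatorFactors m i N)
denomTrunc-isBinomialProduct m i N =
  *F-isBinomialProduct {prodFrom 1 i λ r → poch r r m i N}
                       {prodFrom (suc i) (m ∸ i) λ r → poch r i m i N}
                       {concatBelow i λ j → pochFactors (1 + j) (1 + j) m i N}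
    (prodBelow-isBinomialProduct i _ _ λ j → poch-isBinomialProduct (1 + j) (1 + j) m i N)
    (prodBelow-isBinomialProduct (m ∸ i) _ _ λ j → poch-isBinomialProduct (suc i + j) i m i N)
  where
  poch-isBinomialProduct : ∀ c d C D N → IsBinomialProduct (poch c d C D N) (pochFactors c d C D N)
  poch-isBinomialProduct c d C D N = prodBelow-isBinomialProduct N _ _ λ t f a b → refl

-- Counting solutions

degree : (ℕ × ℕ → ℕ) → (cds : List (ℕ × ℕ)) → Vec ℕ (length cds) → ℕ
degree f []         []      = 0
degree f (cd ∷ cds) (x ∷ v) = x * f cd + degree f cds v

-- Indexes the monomials s^a q^b in the expansion of ∏_((c , d) ∈ cds) 1 / (1 − s^c q^d).
Solutions : List (ℕ × ℕ) → ℕ → ℕ → Set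
Solutions cds a b = Σ (Vec ℕ (length cds)) λ v → degree proj₁ cds v ≡ a × degree proj₂ cds v ≡ b

Solutions-≡ : ∀ {cds a b} {v w : Vec ℕ (length cds)}
              {p : degree proj₁ cds v ≡ a × degree proj₂ cds v ≡ b}
              {q : degree proj₁ cds w ≡ a × degree proj₂ cds w ≡ b} →
              v ≡ w → _≡_ {A = Solutions cds a b} (v , p) (w , q)
Solutions-≡ refl = cong (_ ,_) (cong₂ _,_ (≡-irrelevant _ _) (≡-irrelevant _ _))

Solutions-[]↔ : ∀ a b → Fin (if does (a ≟ 0) ∧ does (b ≟ 0) then 1 else 0) ↔ Solutions [] a b
Solutions-[]↔ zero    zero    = mk↔ₛ′ (λ _ → [] , refl , refl) (λ _ → zero)
                                       (λ { ([] , refl , refl) → refl }) (λ { zero → refl })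
Solutions-[]↔ zero    (suc b) = mk↔ₛ′ (λ ()) (λ { ([] , _ , ()) }) (λ { ([] , _ , ()) }) (λ ())
Solutions-[]↔ (suc a) b       = mk↔ₛ′ (λ ()) (λ { ([] , () , _) }) (λ { ([] , () , _) }) (λ ())

Solutions-∷↔ : ∀ c d cds a b →
  Solutions ((c , d) ∷ cds) a b
  ↔ (Solutions cds a b ⊎ (c ≤ a × d ≤ b × Solutions ((c , d) ∷ cds) (a ∸ c) (b ∸ d)))
Solutions-∷↔ c d cds a b = mk↔ₛ′ to from to∘from from∘to
  where
  lower : ∀ c x r a → c + x * c + r ≡ a → c ≤ a × x * c + r ≡ a ∸ c
  lower c x r a eq = subst (c ≤_) eq (≤-trans (m≤m+n c _) (m≤m+n _ r))
                   , trans (sym (m+n∸m≡n c _)) (cong (_∸ c) (trans (sym (+-assoc c _ r)) eq))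

  raise : ∀ c x r a → c ≤ a → x * c + r ≡ a ∸ c → c + x * c + r ≡ a
  raise c x r a c≤a eq = trans (+-assoc c _ r) (trans (cong (_+_ c) eq) (m+[n∸m]≡n c≤a))

  to : _
  to (zero  ∷ v , p , q) = inj₁ (v , p , q)
  to (suc x ∷ v , p , q) with lower c x _ a p | lower d x _ b q
  ... | c≤a , p′ | d≤b , q′ = inj₂ (c≤a , d≤b , x ∷ v , p′ , q′)

  from : _
  from (inj₁ (v , p , q))                   = zero ∷ v , p , q
  from (inj₂ (c≤a , d≤b , x ∷ v , p , q)) = suc x ∷ v , raise c x _ a c≤a p , raise d x _ b d≤b q

  to∘from : ∀ s → to (from s) ≡ s
  to∘from (inj₁ _) = refl
  to∘from (inj₂ (c≤a , d≤b , x ∷ v , _)) = cong inj₂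
    (cong₂ _,_ (≤-irrelevant _ _) (cong₂ _,_ (≤-irrelevant _ _) (Solutions-≡ refl)))

  from∘to : ∀ s → from (to s) ≡ s
  from∘to (zero  ∷ v , _) = refl
  from∘to (suc x ∷ v , _) = Solutions-≡ refl

Fin-guard : ∀ {n} {P X : Set} (P? : Dec P) → Irrelevant P → (P → Fin n ↔ X) →
            Fin (if does P? then n else 0) ↔ (P × X)
Fin-guard (yes p) irr e = ↔-trans (e p)
  (mk↔ₛ′ (p ,_) proj₂ (λ { (p′ , x) → cong (_, x) (irr p p′) }) (λ _ → refl))
Fin-guard (no ¬p) _   _ = mk↔ₛ′ (λ ()) (λ px → ⊥-elim (¬p (proj₁ px)))
                                 (λ px → ⊥-elim (¬p (proj₁ px))) (λ ())

Finite : Set → Set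
Finite X = Σ ℕ λ n → Fin n ↔ X

Finite-↔ : ∀ {X Y} → Finite X → X ↔ Y → Finite Y
Finite-↔ (n , e) X↔Y = n , ↔-trans e X↔Y

Finite-⊎ : ∀ {X Y} → Finite X → Finite Y → Finite (X ⊎ Y)
Finite-⊎ (n , e) (k , e′) = n + k , ↔-trans +↔⊎ (e ⊎-↔ e′)

Finite-guard : ∀ {P X : Set} → Dec P → Irrelevant P → (P → Finite X) → Finite (P × X)
Finite-guard (yes p) irr fin = _ , Fin-guard (yes p) irr λ _ → proj₂ (fin p)
Finite-guard (no ¬p) irr _   = 0 , Fin-guard {0} (no ¬p) irr λ p → contradiction p ¬p

SPositive : List (ℕ × ℕ) → Set
SPositive = All λ cd → 1 ≤ proj₁ cd

Solutions-finite : ∀ cds → SPositive cds → ∀ a b → Finite (Solutions cds a b)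
Solutions-finite []              []           a b = _ , Solutions-[]↔ a b
Solutions-finite ((c , d) ∷ cds) (1≤c ∷ pos) = <-rec _ step
  where
  step : ∀ a → (∀ {a′} → a′ < a → ∀ b → Finite (Solutions ((c , d) ∷ cds) a′ b)) →
         ∀ b → Finite (Solutions ((c , d) ∷ cds) a b)
  step a rec b = Finite-↔
    (Finite-⊎ (Solutions-finite cds pos a b)
              (Finite-guard (c ≤? a) ≤-irrelevant λ c≤a →
               Finite-guard (d ≤? b) ≤-irrelevant λ _ →
               rec (∸-monoʳ-< 1≤c c≤a) (b ∸ d)))
    (↔-sym (Solutions-∷↔ c d cds a b))

count : ∀ cds → SPositive cds → ℕ → ℕ → ℕ
count cds pos a b = proj₁ (Solutions-finite cds pos a b)

count-↔ : ∀ cds pos a b → Fin (count cds pos a b) ↔ Solutions cds a b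
count-↔ cds pos a b = proj₂ (Solutions-finite cds pos a b)

count-∷ : ∀ c d cds 1≤c pos a b →
          let n = count ((c , d) ∷ cds) (1≤c ∷ pos) in
          n a b ≡ count cds pos a b
                + (if does (c ≤? a) then (if does (d ≤? b) then n (a ∸ c) (b ∸ d) else 0) else 0)
count-∷ c d cds 1≤c pos a b = ↔⇒≡ (↔-trans (count-↔ cds′ pos′ a b) (↔-trans
  (Solutions-∷↔ c d cds a b)
  (↔-sym (↔-trans +↔⊎
    (count-↔ cds pos a b ⊎-↔
     Fin-guard (c ≤? a) ≤-irrelevant λ _ → Fin-guard (d ≤? b) ≤-irrelevant λ _ →
     count-↔ cds′ pos′ (a ∸ c) (b ∸ d))))))
  where
  cds′ = (c , d) ∷ cds
  pos′ = 1≤c ∷ pos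

-- By count-∷, G = G′ + s^c q^d G for the counting series G of (c , d) ∷ cds and G′ of cds.
count-*F-oneMinus : ∀ c d cds 1≤c pos →
                    (toFPS (count ((c , d) ∷ cds) (1≤c ∷ pos)) *F oneMinus c d)
                    ≈ toFPS (count cds pos)
count-*F-oneMinus c d cds 1≤c pos a b = begin
  (toFPS n *F oneMinus c d) a b             ≡⟨ *F-oneMinus c d (toFPS n) a b ⟩
  + n a b -ℤ shift c d (toFPS n) a b        ≡⟨ cong₂ _-ℤ_ (cong +_ (count-∷ c d cds 1≤c pos a b))
                                                         shift-toFPS ⟩
  + (count cds pos a b + k) -ℤ + k          ≡⟨ cong (_-ℤ + k) (ℤP.pos-+ (count cds pos a b) k) ⟩
  (+ count cds pos a b +ℤ + k) -ℤ + k      ≡⟨ +-minus-cancel (+ count cds pos a b) (+ k) ⟩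
  + count cds pos a b                       ∎
  where
  open ≡-Reasoning
  n = count ((c , d) ∷ cds) (1≤c ∷ pos)
  k = if does (c ≤? a) then (if does (d ≤? b) then n (a ∸ c) (b ∸ d) else 0) else 0

  shift-toFPS : shift c d (toFPS n) a b ≡ + k
  shift-toFPS = sym (trans (if-float +_ (does (c ≤? a)))
    (cong (λ t → if does (c ≤? a) then t else + 0) (if-float +_ (does (d ≤? b)))))

  +-minus-cancel : ∀ x y → (x +ℤ y) -ℤ y ≡ x
  +-minus-cancel = ℤ-Ring.solve-∀

mulBinomials-count : ∀ cds pos → mulBinomials (toFPS (count cds pos)) cds ≈ oneF
mulBinomials-count []              []           a b = if-float +_ (does (a ≟ 0) ∧ does (b ≟ 0))
mulBinomials-count ((c , d) ∷ cds) (1≤c ∷ pos) = ≈-trans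
  (mulBinomials-cong cds (count-*F-oneMinus c d cds 1≤c pos))
  (mulBinomials-count cds pos)

permuteVec : ∀ {A : Set} {xs ys : List A} → xs ↭ ys → Vec ℕ (length xs) → Vec ℕ (length ys)
permuteVec ↭.refl             v           = v
permuteVec (↭.prep _ p)       (x ∷ v)     = x ∷ permuteVec p v
permuteVec (↭.swap _ _ p)     (x ∷ y ∷ v) = y ∷ x ∷ permuteVec p v
permuteVec (↭.trans p₁ p₂)  v           = permuteVec p₂ (permuteVec p₁ v)

permuteVec-sym : ∀ {A : Set} {xs ys : List A} (p : xs ↭ ys) v →
                 permuteVec (↭-sym p) (permuteVec p v) ≡ v
permuteVec-sym ↭.refl            v           = refl
permuteVec-sym (↭.prep _ p)      (x ∷ v)     = cong (x ∷_) (permuteVec-sym p v)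
permuteVec-sym (↭.swap _ _ p)    (x ∷ y ∷ v) = cong (λ w → x ∷ y ∷ w) (permuteVec-sym p v)
permuteVec-sym (↭.trans p₁ p₂) v           =
  trans (cong (permuteVec (↭-sym p₁)) (permuteVec-sym p₂ (permuteVec p₁ v))) (permuteVec-sym p₁ v)

permuteVec-sym′ : ∀ {A : Set} {xs ys : List A} (p : xs ↭ ys) w →
                  permuteVec p (permuteVec (↭-sym p) w) ≡ w
permuteVec-sym′ p w =
  subst (λ p′ → permuteVec p′ (permuteVec (↭-sym p) w) ≡ w) (↭-sym-involutive p)
        (permuteVec-sym (↭-sym p) w)

degree-permuteVec : ∀ f {cds cds′} (p : cds ↭ cds′) v →
                    degree f cds′ (permuteVec p v) ≡ degree f cds v
degree-permuteVec f ↭.refl             v           = refl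
degree-permuteVec f (↭.prep cd p)      (x ∷ v)     = cong (λ r → x * f cd + r) (degree-permuteVec f p v)
degree-permuteVec f (↭.swap cd cd′ p)  (x ∷ y ∷ v) =
  trans (cong (λ r → y * f cd′ + (x * f cd + r)) (degree-permuteVec f p v))
        (x∙yz≈y∙xz (y * f cd′) (x * f cd) _)
degree-permuteVec f (↭.trans p₁ p₂)  v           =
  trans (degree-permuteVec f p₂ (permuteVec p₁ v)) (degree-permuteVec f p₁ v)

Solutions-↭ : ∀ {cds cds′} → cds ↭ cds′ → ∀ a b → Solutions cds a b ↔ Solutions cds′ a b
Solutions-↭ {cds} {cds′} p a b = mk↔ₛ′ (transport p) (transport (↭-sym p))
  (λ { (w , _) → Solutions-≡ {cds′} (permuteVec-sym′ p w) })
  (λ { (v , _) → Solutions-≡ {cds} (permuteVec-sym p v) })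
  where
  transport : ∀ {cds cds′} → cds ↭ cds′ → Solutions cds a b → Solutions cds′ a b
  transport p (v , eq₁ , eq₂) = permuteVec p v
    , trans (degree-permuteVec proj₁ p v) eq₁ , trans (degree-permuteVec proj₂ p v) eq₂

-- Partitions by column multiplicities

firstPart : List ℕ → ℕ
firstPart []      = 0
firstPart (x ∷ _) = x

consDiff : ℕ → List ℕ → List ℕ
consDiff x       (y ∷ l) = x + y ∷ y ∷ l
consDiff zero    []      = []
consDiff (suc x) []      = [ suc x ]

-- The partition with v_k columns of height k, i.e. with λ_k − λ_(k+1) = v_k.
fromDiffs : ∀ {n} → Vec ℕ n → List ℕ
fromDiffs []      = []
fromDiffs (x ∷ v) = consDiff x (fromDiffs v)

diffs : (n : ℕ) → List ℕ → Vec ℕ n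
diffs zero    _       = []
diffs (suc n) []      = 0 ∷ diffs n []
diffs (suc n) (x ∷ l) = x ∸ firstPart l ∷ diffs n l

firstPart-consDiff : ∀ x l → firstPart (consDiff x l) ≡ x + firstPart l
firstPart-consDiff zero    []      = refl
firstPart-consDiff (suc x) []      = sym (+-identityʳ (suc x))
firstPart-consDiff x       (y ∷ l) = refl

firstPart-fromDiffs : ∀ {n} (v : Vec ℕ n) → firstPart (fromDiffs v) ≡ Vec.sum v
firstPart-fromDiffs []      = refl
firstPart-fromDiffs (x ∷ v) =
  trans (firstPart-consDiff x (fromDiffs v)) (cong (_+_ x) (firstPart-fromDiffs v))

size-consDiff : ∀ x l → size (consDiff x l) ≡ x + firstPart l + size l
size-consDiff zero    []      = refl
size-consDiff (suc x) []      = cong (_+ 0) (sym (+-identityʳ (suc x)))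
size-consDiff x       (y ∷ l) = refl

diffs-consDiff : ∀ n x l → diffs (suc n) (consDiff x l) ≡ x ∷ diffs n l
diffs-consDiff n zero    []      = refl
diffs-consDiff n (suc x) []      = refl
diffs-consDiff n x       (y ∷ l) = cong (_∷ diffs n (y ∷ l)) (m+n∸n≡m x y)

diffs-fromDiffs : ∀ {n} (v : Vec ℕ n) → diffs n (fromDiffs v) ≡ v
diffs-fromDiffs []          = refl
diffs-fromDiffs {suc n} (x ∷ v) =
  trans (diffs-consDiff n x (fromDiffs v)) (cong (x ∷_) (diffs-fromDiffs v))

IsPartition-consDiff : ∀ x l → IsPartition l → IsPartition (consDiff x l)
IsPartition-consDiff zero    []      _                   = [] , []
IsPartition-consDiff (suc x) []      _                   = [-] , (s≤s z≤n ∷ [])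
IsPartition-consDiff x       (y ∷ l) (sorted , 0<y ∷ pos) =
  (m≤n+m y x ∷ sorted) , (<-≤-trans 0<y (m≤n+m y x) ∷ 0<y ∷ pos)

IsPartition-fromDiffs : ∀ {n} (v : Vec ℕ n) → IsPartition (fromDiffs v)
IsPartition-fromDiffs []      = [] , []
IsPartition-fromDiffs (x ∷ v) = IsPartition-consDiff x (fromDiffs v) (IsPartition-fromDiffs v)

IsPartition-tail : ∀ {x l} → IsPartition (x ∷ l) → IsPartition l
IsPartition-tail ([-]        , _ ∷ pos) = [] , pos
IsPartition-tail ((_ ∷ sorted) , _ ∷ pos) = sorted , pos

consDiff-diff : ∀ x l → IsPartition (x ∷ l) → consDiff (x ∸ firstPart l) l ≡ x ∷ l
consDiff-diff zero    []      (_ , () ∷ _)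
consDiff-diff (suc x) []      _                 = refl
consDiff-diff x       (y ∷ l) ((y≤x ∷ _) , _) = cong (_∷ y ∷ l) (m∸n+n≡m y≤x)

fromDiffs-diffs : ∀ n l → IsPartition l → length l ≤ n → fromDiffs (diffs n l) ≡ l
fromDiffs-diffs zero    []      _     _          = refl
fromDiffs-diffs (suc n) []      _     _          = cong (consDiff 0) (fromDiffs-diffs n [] ([] , []) z≤n)
fromDiffs-diffs (suc n) (x ∷ l) ptn (s≤s len≤n) = trans
  (cong (consDiff (x ∸ firstPart l)) (fromDiffs-diffs n l (IsPartition-tail ptn) len≤n))
  (consDiff-diff x l ptn)

length≤size : ∀ l → All (0 <_) l → length l ≤ size l
length≤size []      []          = z≤n
length≤size (x ∷ l) (0<x ∷ pos) = +-mono-≤ 0<x (length≤size l pos)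

⊓-step : ∀ r i → r ⊓ i + (if does (r <? i) then 1 else 0) ≡ suc r ⊓ i
⊓-step r i with r <? i
... | yes r<i = begin
  r ⊓ i + (if does (r <? i) then 1 else 0)
    ≡⟨ cong₂ _+_ (m≤n⇒m⊓n≡m (<⇒≤ r<i)) (if-yes (r <? i) r<i) ⟩
  r + 1                                    ≡⟨ +-comm r 1 ⟩
  suc r                                    ≡⟨ m≤n⇒m⊓n≡m r<i ⟨
  suc r ⊓ i                                ∎
  where open ≡-Reasoning
... | no r≮i = begin
  r ⊓ i + (if does (r <? i) then 1 else 0)
    ≡⟨ cong₂ _+_ (m≥n⇒m⊓n≡n i≤r) (if-no (r <? i) r≮i) ⟩
  i + 0                                    ≡⟨ +-identityʳ i ⟩
  i                                        ≡⟨ m≥n⇒m⊓n≡n (m≤n⇒m≤1+n i≤r) ⟨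
  suc r ⊓ i                                ∎
  where
  open ≡-Reasoning
  i≤r = ≮⇒≥ r≮i

-- Column weights

module _ (m i : ℕ) .{{_ : NonZero m}} where

  counted : ℕ → Bool
  counted p = does ((p ∸ 1) % m <? i)

  -- The statistic of the single column (1, …, 1) with k parts.
  columnWeight : ℕ → ℕ
  columnWeight zero    = 0
  columnWeight (suc k) = columnWeight k + (if counted (suc k) then 1 else 0)

  column : ℕ → ℕ × ℕ
  column k = k , columnWeight k

  columnFactors : ℕ → ℕ → List (ℕ × ℕ)
  columnFactors o zero    = []
  columnFactors o (suc H) = column (suc o) ∷ columnFactors (suc o) H

  columnFactors-length : ∀ o H → length (columnFactors o H) ≡ H
  columnFactors-length o zero    = refl
  columnFactors-length o (suc H) = cong suc (columnFactors-length (suc o) H)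

  columnFactors-positive : ∀ o H → SPositive (columnFactors o H)
  columnFactors-positive o zero    = []
  columnFactors-positive o (suc H) = s≤s z≤n ∷ columnFactors-positive (suc o) H

  weightFrom-consDiff : ∀ p x l → weightFrom m i p (consDiff x l)
                        ≡ (if counted p then x + firstPart l else 0) + weightFrom m i (suc p) l
  weightFrom-consDiff p zero    []      = sym (trans (+-identityʳ _) (if-eta (counted p)))
  weightFrom-consDiff p (suc x) []      =
    cong (λ t → (if counted p then t else 0) + 0) (sym (+-identityʳ (suc x)))
  weightFrom-consDiff p x       (y ∷ l) = refl

  size-fromDiffs : ∀ o H (v : Vec ℕ (length (columnFactors o H))) →
                   o * Vec.sum v + size (fromDiffs v) ≡ degree proj₁ (columnFactors o H) v
  size-fromDiffs o zero    []      = trans (+-identityʳ _) (*-zeroʳ o)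
  size-fromDiffs o (suc H) (x ∷ v) = begin
    o * (x + S) + size (consDiff x (fromDiffs v))
      ≡⟨ cong (λ t → o * (x + S) + t) (size-consDiff x (fromDiffs v)) ⟩
    o * (x + S) + (x + firstPart (fromDiffs v) + W)
      ≡⟨ cong (λ t → o * (x + S) + (x + t + W)) (firstPart-fromDiffs v) ⟩
    o * (x + S) + (x + S + W)
      ≡⟨ regroup o x S W ⟩
    x * suc o + (suc o * S + W)
      ≡⟨ cong (λ t → x * suc o + t) (size-fromDiffs (suc o) H v) ⟩
    degree proj₁ (columnFactors o (suc H)) (x ∷ v) ∎
    where
    open ≡-Reasoning
    S = Vec.sum v
    W = size (fromDiffs v)
    regroup : ∀ o x S W → o * (x + S) + (x + S + W) ≡ x * suc o + (suc o * S + W)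
    regroup = ℕ-Ring.solve-∀

  weight-fromDiffs : ∀ o H (v : Vec ℕ (length (columnFactors o H))) →
                     columnWeight o * Vec.sum v + weightFrom m i (suc o) (fromDiffs v)
                     ≡ degree proj₂ (columnFactors o H) v
  weight-fromDiffs o zero    []      = trans (+-identityʳ _) (*-zeroʳ (columnWeight o))
  weight-fromDiffs o (suc H) (x ∷ v) = begin
    w * (x + S) + weightFrom m i (suc o) (consDiff x (fromDiffs v))
      ≡⟨ cong (λ t → w * (x + S) + t) (weightFrom-consDiff (suc o) x (fromDiffs v)) ⟩
    w * (x + S) + ((if counted (suc o) then x + firstPart (fromDiffs v) else 0) + W)
      ≡⟨ cong (λ t → w * (x + S) + ((if counted (suc o) then x + t else 0) + W))
              (firstPart-fromDiffs v) ⟩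
    w * (x + S) + ((if counted (suc o) then x + S else 0) + W)
      ≡⟨ cong (λ t → w * (x + S) + (t + W)) (if-as-product (counted (suc o)) (x + S)) ⟩
    w * (x + S) + (g * (x + S) + W)
      ≡⟨ regroup w g x S W ⟩
    x * (w + g) + ((w + g) * S + W)
      ≡⟨ cong (λ t → x * (w + g) + t) (weight-fromDiffs (suc o) H v) ⟩
    degree proj₂ (columnFactors o (suc H)) (x ∷ v) ∎
    where
    open ≡-Reasoning
    w = columnWeight o
    g = if counted (suc o) then 1 else 0
    S = Vec.sum v
    W = weightFrom m i (suc (suc o)) (fromDiffs v)
    if-as-product : ∀ b n → (if b then n else 0) ≡ (if b then 1 else 0) * n
    if-as-product true  n = sym (+-identityʳ n)
    if-as-product false n = refl
    regroup : ∀ w g x S W → w * (x + S) + (g * (x + S) + W) ≡ x * (w + g) + ((w + g) * S + W)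
    regroup = ℕ-Ring.solve-∀

  PartSet-≡ : ∀ {a b} {l l′ : List ℕ}
              {p : IsPartition l × size l ≡ a × stat m i l ≡ b}
              {q : IsPartition l′ × size l′ ≡ a × stat m i l′ ≡ b} →
              l ≡ l′ → _≡_ {A = PartSet m i a b} (l , p) (l′ , q)
  PartSet-≡ {p = (sorted , pos) , _} {q = (sorted′ , pos′) , _} refl = cong (_ ,_)
    (cong₂ _,_ (cong₂ _,_ (Linked.irrelevant ≤-irrelevant sorted sorted′)
                          (All.irrelevant ≤-irrelevant pos pos′))
               (cong₂ _,_ (≡-irrelevant _ _) (≡-irrelevant _ _)))

  PartSet↔Solutions : ∀ H a b → a ≤ H → PartSet m i a b ↔ Solutions (columnFactors 0 H) a b
  PartSet↔Solutions H a b a≤H = mk↔ₛ′ to from to∘from from∘to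
    where
    n = length (columnFactors 0 H)

    fromDiffs-diffs′ : ∀ l → IsPartition l → size l ≡ a → fromDiffs (diffs n l) ≡ l
    fromDiffs-diffs′ l ptn refl = fromDiffs-diffs n l ptn
      (subst (length l ≤_) (sym (columnFactors-length 0 H))
             (≤-trans (length≤size l (proj₂ ptn)) a≤H))

    to : PartSet m i a b → Solutions (columnFactors 0 H) a b
    to (l , ptn , size≡ , stat≡) = diffs n l
      , trans (sym (size-fromDiffs 0 H (diffs n l)))
              (trans (cong size (fromDiffs-diffs′ l ptn size≡)) size≡)
      , trans (sym (weight-fromDiffs 0 H (diffs n l)))
              (trans (cong (stat m i) (fromDiffs-diffs′ l ptn size≡)) stat≡)

    from : Solutions (columnFactors 0 H) a b → PartSet m i a b
    from (v , size≡ , stat≡) = fromDiffs v , IsPartition-fromDiffs v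
      , trans (size-fromDiffs 0 H v) size≡ , trans (weight-fromDiffs 0 H v) stat≡

    to∘from : ∀ s → to (from s) ≡ s
    to∘from (v , _) = Solutions-≡ {columnFactors 0 H} (diffs-fromDiffs v)

    from∘to : ∀ λ′ → from (to λ′) ≡ λ′
    from∘to (l , ptn , size≡ , _) = PartSet-≡ (fromDiffs-diffs′ l ptn size≡)

  columnFactors-++ : ∀ o h h′ →
                     columnFactors o (h + h′) ≡ columnFactors o h ++ columnFactors (o + h) h′
  columnFactors-++ o zero    h′ = cong (λ o′ → columnFactors o′ h′) (sym (+-identityʳ o))
  columnFactors-++ o (suc h) h′ = cong (column (suc o) ∷_) (trans
    (columnFactors-++ (suc o) h h′)
    (cong (λ o′ → columnFactors (suc o) h ++ columnFactors o′ h′) (sym (+-suc o h))))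

  concatBelow-columns : ∀ K o (f : ℕ → ℕ × ℕ) → (∀ j → j < K → f j ≡ column (suc (o + j))) →
                        concatBelow K (λ j → [ f j ]) ≡ columnFactors o K
  concatBelow-columns zero    o f f≡ = refl
  concatBelow-columns (suc K) o f f≡ = begin
    concatBelow K (λ j → [ f j ]) ++ [ f K ]
      ≡⟨ cong₂ _++_ (concatBelow-columns K o f λ j j<K → f≡ j (m<n⇒m<1+n j<K))
                    (cong [_] (f≡ K ≤-refl)) ⟩
    columnFactors o K ++ columnFactors (o + K) 1
      ≡⟨ columnFactors-++ o K 1 ⟨
    columnFactors o (K + 1)
      ≡⟨ cong (columnFactors o) (+-comm K 1) ⟩
    columnFactors o (suc K) ∎
    where open ≡-Reasoning

  columnFactors-blocks : ∀ N →
                         concatBelow N (λ t → columnFactors (m * t) m) ≡ columnFactors 0 (m * N)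
  columnFactors-blocks zero    = cong (columnFactors 0) (sym (*-zeroʳ m))
  columnFactors-blocks (suc N) = begin
    concatBelow N (λ t → columnFactors (m * t) m) ++ columnFactors (m * N) m
      ≡⟨ cong (_++ columnFactors (m * N) m) (columnFactors-blocks N) ⟩
    columnFactors 0 (m * N) ++ columnFactors (m * N) m
      ≡⟨ columnFactors-++ 0 (m * N) m ⟨
    columnFactors 0 (m * N + m)
      ≡⟨ cong (columnFactors 0) (trans (+-comm (m * N) m) (sym (*-suc m N))) ⟩
    columnFactors 0 (m * suc N) ∎
    where open ≡-Reasoning

  counted-block : ∀ t r → r < m → counted (suc (m * t + r)) ≡ does (r <? i)
  counted-block t r r<m = cong (λ k → does (k <? i)) (begin
    (m * t + r) % m ≡⟨ cong (_% m) (trans (+-comm (m * t) r) (cong (_+_ r) (*-comm m t))) ⟩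
    (r + t * m) % m ≡⟨ [m+kn]%n≡m%n r t m ⟩
    r % m           ≡⟨ m<n⇒m%n≡m r<m ⟩
    r               ∎)
    where open ≡-Reasoning

  module _ (i≤m : i ≤ m) where

    columnWeight-block    : ∀ t r → r ≤ m → columnWeight (m * t + r) ≡ i * t + r ⊓ i
    columnWeight-multiple : ∀ t → columnWeight (m * t) ≡ i * t

    columnWeight-block t zero    _   = begin
      columnWeight (m * t + 0) ≡⟨ cong columnWeight (+-identityʳ (m * t)) ⟩
      columnWeight (m * t)     ≡⟨ columnWeight-multiple t ⟩
      i * t                    ≡⟨ +-identityʳ (i * t) ⟨
      i * t + 0                ∎
      where open ≡-Reasoning
    columnWeight-block t (suc r) r<m = begin
      columnWeight (m * t + suc r)
        ≡⟨ cong columnWeight (+-suc (m * t) r) ⟩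
      columnWeight (m * t + r) + (if counted (suc (m * t + r)) then 1 else 0)
        ≡⟨ cong₂ _+_ (columnWeight-block t r (<⇒≤ r<m))
                     (cong (if_then 1 else 0) (counted-block t r r<m)) ⟩
      i * t + r ⊓ i + (if does (r <? i) then 1 else 0)
        ≡⟨ +-assoc (i * t) (r ⊓ i) _ ⟩
      i * t + (r ⊓ i + (if does (r <? i) then 1 else 0))
        ≡⟨ cong (_+_ (i * t)) (⊓-step r i) ⟩
      i * t + suc r ⊓ i ∎
      where open ≡-Reasoning

    columnWeight-multiple zero    = trans (cong columnWeight (*-zeroʳ m)) (sym (*-zeroʳ i))
    columnWeight-multiple (suc t) = begin
      columnWeight (m * suc t) ≡⟨ cong columnWeight (trans (*-suc m t) (+-comm m (m * t))) ⟩
      columnWeight (m * t + m) ≡⟨ columnWeight-block t m ≤-refl ⟩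
      i * t + m ⊓ i            ≡⟨ cong (_+_ (i * t)) (m≥n⇒m⊓n≡n i≤m) ⟩
      i * t + i                ≡⟨ +-comm (i * t) i ⟩
      i + i * t                ≡⟨ *-suc i t ⟨
      i * suc t                ∎
      where open ≡-Reasoning

    lowerColumn : ∀ t j → j < i → (1 + j + m * t , 1 + j + i * t) ≡ column (suc (m * t + j))
    lowerColumn t j j<i = cong₂ _,_ (cong suc (+-comm j (m * t))) (sym (begin
      columnWeight (suc (m * t + j)) ≡⟨ cong columnWeight (+-suc (m * t) j) ⟨
      columnWeight (m * t + suc j)   ≡⟨ columnWeight-block t (suc j) (≤-trans j<i i≤m) ⟩
      i * t + suc j ⊓ i              ≡⟨ cong (_+_ (i * t)) (m≤n⇒m⊓n≡m j<i) ⟩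
      i * t + suc j                  ≡⟨ +-comm (i * t) (suc j) ⟩
      suc j + i * t                  ∎))
      where open ≡-Reasoning

    upperColumn : ∀ t j → j < m ∸ i → (suc i + j + m * t , i + i * t) ≡ column (suc (m * t + i + j))
    upperColumn t j j<m∸i = cong₂ _,_ (cong suc (rotate i j (m * t))) (sym (begin
      columnWeight (suc (m * t + i + j)) ≡⟨ cong columnWeight (reassoc (m * t) i j) ⟩
      columnWeight (m * t + (i + suc j)) ≡⟨ columnWeight-block t (i + suc j) i+1+j≤m ⟩
      i * t + (i + suc j) ⊓ i            ≡⟨ cong (_+_ (i * t)) (m≥n⇒m⊓n≡n (m≤m+n i (suc j))) ⟩
      i * t + i                          ≡⟨ +-comm (i * t) i ⟩
      i + i * t                          ∎))
      where
      open ≡-Reasoning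
      rotate : ∀ i j k → i + j + k ≡ k + i + j
      rotate = ℕ-Ring.solve-∀
      reassoc : ∀ k i j → 1 + (k + i + j) ≡ k + (i + (1 + j))
      reassoc = ℕ-Ring.solve-∀
      i+1+j≤m : i + suc j ≤ m
      i+1+j≤m = subst (_≤ m) (sym (+-suc i j))
                      (subst (suc (i + j) ≤_) (m+[n∸m]≡n i≤m) (+-monoʳ-< i j<m∸i))

    columnBlock : ∀ t → concatBelow i (λ j → [ (1 + j + m * t , 1 + j + i * t) ])
                        ++ concatBelow (m ∸ i) (λ j → [ (suc i + j + m * t , i + i * t) ])
                        ≡ columnFactors (m * t) m
    columnBlock t = begin
      concatBelow i (λ j → [ (1 + j + m * t , 1 + j + i * t) ])
        ++ concatBelow (m ∸ i) (λ j → [ (suc i + j + m * t , i + i * t) ])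
        ≡⟨ cong₂ _++_ (concatBelow-columns i (m * t) _ (lowerColumn t))
                      (concatBelow-columns (m ∸ i) (m * t + i) _ (upperColumn t)) ⟩
      columnFactors (m * t) i ++ columnFactors (m * t + i) (m ∸ i)
        ≡⟨ columnFactors-++ (m * t) i (m ∸ i) ⟨
      columnFactors (m * t) (i + (m ∸ i))
        ≡⟨ cong (columnFactors (m * t)) (m+[n∸m]≡n i≤m) ⟩
      columnFactors (m * t) m ∎
      where open ≡-Reasoning

    denominatorFactors-↭ : ∀ N → denominatorFactors m i N ↭ columnFactors 0 (m * N)
    denominatorFactors-↭ N = begin
      concatBelow i (λ j → concatBelow N (lower j))
        ++ concatBelow (m ∸ i) (λ j → concatBelow N (upper j))
        ↭⟨ ++⁺ (concatBelow-transpose i N lower) (concatBelow-transpose (m ∸ i) N upper) ⟩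
      concatBelow N (λ t → concatBelow i (λ j → lower j t))
        ++ concatBelow N (λ t → concatBelow (m ∸ i) (λ j → upper j t))
        ↭⟨ concatBelow-++ N _ _ ⟨
      concatBelow N (λ t → concatBelow i (λ j → lower j t)
                           ++ concatBelow (m ∸ i) (λ j → upper j t))
        ≡⟨ concatBelow-cong N columnBlock ⟩
      concatBelow N (λ t → columnFactors (m * t) m)
        ≡⟨ columnFactors-blocks N ⟩
      columnFactors 0 (m * N) ∎
      where
      open PermutationReasoning
      lower upper : ℕ → ℕ → List (ℕ × ℕ)
      lower j t = [ (1 + j + m * t , 1 + j + i * t) ]
      upper j t = [ (suc i + j + m * t , i + i * t) ]

mainTheorem5 : (m i : ℕ) → .{{_ : NonZero m}} → 2 ≤ m → 1 ≤ i → i ≤ m →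
               (L : ℕ → ℕ → ℕ) →
               (∀ n k → Fin (L n k) ↔ PartSet m i n k) →
               ∀ a b N → a < N →
               (toFPS L *F denomTrunc m i N) a b ≡ oneF a b
mainTheorem5 m i _ _ i≤m L L↔ a b N a<N = begin
  (toFPS L *F denomTrunc m i N) a b          ≡⟨ denomTrunc-isBinomialProduct m i N (toFPS L) a b ⟩
  mulBinomials (toFPS L) cds a b             ≡⟨ mulBinomials-agreeBelow N cds L≡count a b a<N ⟩
  mulBinomials (toFPS (count cds pos)) cds a b ≡⟨ mulBinomials-count cds pos a b ⟩
  oneF a b                                   ∎
  where
  open ≡-Reasoning
  cds = denominatorFactors m i N
  cds↭columns = denominatorFactors-↭ m i i≤m N
  pos = All-resp-↭ (↭-sym cds↭columns) (columnFactors-positive m i 0 (m * N))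

  -- Columns of height above m N ≥ N cannot occur in a partition of a < N.
  L≡count : ∀ a b → a < N → toFPS L a b ≡ toFPS (count cds pos) a b
  L≡count a b a<N = cong +_ (↔⇒≡ (↔-trans (L↔ a b) (↔-trans
    (PartSet↔Solutions m i (m * N) a b (≤-trans (<⇒≤ a<N) (m≤n*m N m)))
    (↔-trans (Solutions-↭ (↭-sym cds↭columns) a b) (↔-sym (count-↔ cds pos a b))))))
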